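{- In a GSP $\Pi$ of an SF instance, no two distinct agents $a_i,a_j$ can appear consecutively (i.e., one as the image of the other) in two separate cyclic permutations of $\Pi$.
   Context: A Stable Fixtures (SF) instance is $I=(A,\succ,c)$ where $A=\{a_1,\dots,a_n\}$ is a finite set of $n$ agents; each agent $a_i$ has a strict linear order $\succ_i$ over $A\setminus\{a_i\}$ (complete preference list), with the convention that every agent ranks itself last ($a_j\succ_i a_i$ for all $j\neq i$); $a\succeq_i b$ means $a\succ_i b$ or $a=b$. Each agent has an integer capacity $c_i$ with $1\le c_i<n$. A cyclic permutation of a nonempty set $A_r\subseteq A$ is a permutation $\Pi_r$ of $A_r$ consisting of a single cycle of length $|A_r|$ (length 1: a fixed point $(a_i)$; length 2: a transposition $(a_i\ a_j)$). Two cyclic permutations are distinct if some element is mapped to different elements by them. A GSP (generalised stable partition) of $I$ is a finite collection $\Pi=\{\Pi_1,\dots,\Pi_k\}$ of cyclic permutations $\Pi_r$ of sets $A_r\subseteq A$, pairwise distinct except that fixed points may be repeated, such that: (F1) for every $r$ and every $a_j\in A_r$, $\Pi_r(a_j)\succeq_j\Pi_r^{ -1}(a_j)$; (F2) there are no distinct $a_i,a_j\in A$ with the transposition $(a_i\ a_j)\notin\Pi$ such that $a_j\succ_i\Pi_r^{ -1}(a_i)$ and $a_i\succ_j\Pi_s^{ -1}(a_j)$ for some $\Pi_r,\Pi_s\in\Pi$ with $a_i\in A_r$, $a_j\in A_s$; (F3) for every $a_i\in A$, the number of indices $r$ with $a_i\in A_r$ equals $c_i$; (F4) for all distinct $a_i,a_j\in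 A$, $|\{s:\Pi_s(a_i)=a_j\}|+|\{s:\Pi_s(a_j)=a_i\}|\le 2$. -}

module Defs where

open import Data.Nat using (ℕ; zero; suc; _+_; _<_; _≤_)
open import Data.Fin using (Fin; _≟_)
open import Data.Fin as F using ()
open import Data.Bool using (Bool; true; false; _∧_; _∨_; T; if_then_else_)
open import Data.List using (List; []; _∷_; _++_; take; length)
open import Data.List.Membership.Propositional using (_∈_)
open import Data.List.Relation.Unary.Unique.Propositional using (Unique)
open import Data.Product using (Σ; ∃; _×_; _,_)
open import Data.Sum using (_⊎_)
open import Function using (_∘_; _⇔_)
open import Function.Definitions using (Injective)
open import Relation.Binary.PropositionalEquality using (_≡_; _≢_)
open import Relation.Nullary using (¬_; does)
open import Data.List.Relation.Unary.Any using (any?)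

-- A cyclic permutation of a nonempty set A_r of agents
-- is represented by a nonempty duplicate-free list [x₀, …, x_{m-1}],
-- meaning x₀ ↦ x₁ ↦ … ↦ x_{m-1} ↦ x₀ (a singleton [x] is the fixed point (x)).

consec : ∀ {n} → List (Fin n) → Fin n → Fin n → Bool
consec (a ∷ b ∷ rest) x y = (does (a ≟ x) ∧ does (b ≟ y)) ∨ consec (b ∷ rest) x y
consec _ x y = false

next : ∀ {n} → List (Fin n) → Fin n → Fin n → Bool
next xs x y = consec (xs ++ take 1 xs) x y

Maps : ∀ {n} → List (Fin n) → Fin n → Fin n → Set
Maps xs x y = T (next xs x y)

memb : ∀ {n} → Fin n → List (Fin n) → Bool
memb x xs = does (any? (x ≟_) xs)

SamePerm : ∀ {n} → List (Fin n) → List (Fin n) → Set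
SamePerm xs ys = (∀ x → (x ∈ xs) ⇔ (x ∈ ys)) × (∀ x y → next xs x y ≡ next ys x y)

count : ∀ {k} → (Fin k → Bool) → ℕ
count {zero} f = 0
count {suc k} f = (if f F.zero then 1 else 0) + count (f ∘ F.suc)

-- Preferences of agent i are given by a rank
-- function rank i : Fin n → ℕ (smaller = better), injective (strict, complete
-- linear order), with i itself ranked strictly last.

record SF (n : ℕ) : Set where
  field
    rank      : Fin n → Fin n → ℕ
    rank-inj  : ∀ i → Injective _≡_ _≡_ (rank i)
    self-last : ∀ i j → j ≢ i → rank i j < rank i i
    cap       : Fin n → ℕ
    cap-pos   : ∀ i → 1 ≤ cap i
    cap-lt    : ∀ i → cap i < n

  Prefers : Fin n → Fin n → Fin n → Set
  Prefers i a b = rank i a < rank i b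

  PrefersEq : Fin n → Fin n → Fin n → Set
  PrefersEq i a b = a ≡ b ⊎ Prefers i a b

record GSP {n : ℕ} (I : SF n) : Set where
  open SF I
  field
    k        : ℕ
    Π        : Fin k → List (Fin n)
    nonempty : ∀ r → Π r ≢ []
    unique   : ∀ r → Unique (Π r)
    -- pairwise distinct, except that fixed points may be repeated
    distinct : ∀ r s → r ≢ s → SamePerm (Π r) (Π s) → length (Π r) ≡ 1
    F1 : ∀ r a b c → Maps (Π r) a b → Maps (Π r) c a → PrefersEq a b c
    -- (F2) no blocking pair
    F2 : ∀ i j → i ≢ j
         → (∀ r → Π r ≢ i ∷ j ∷ [] × Π r ≢ j ∷ i ∷ [])
         → ¬ ((∃ λ r → ∃ λ p → Maps (Π r) p i × Prefers i j p)
              × (∃ λ s → ∃ λ q → Maps (Π s) q j × Prefers j i q))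
    F3 : ∀ i → count (λ r → memb i (Π r)) ≡ cap i
    F4 : ∀ i j → i ≢ j → count (λ s → next (Π s) i j) + count (λ s → next (Π s) j i) ≤ 2

Adjacent : ∀ {n} → List (Fin n) → Fin n → Fin n → Set
Adjacent xs a b = Maps xs a b ⊎ Maps xs b a

-- In a cycle of length at least 3 the predecessor of an agent x is pinned
-- down by stability: if x had predecessors p ≠ p′ in two such cycles and
-- preferred p, then p, preferring x to its own predecessor by (F1), would form
-- a blocking pair with x, and (x p) cannot be a transposition of Π by (F4).
-- Walking backwards along the cycle, two long cycles that share an agent
-- therefore coincide, contradicting distinctness.  If one of the two cycles is
-- the transposition (i j) instead, the other one adds a third i–j step,
-- again contradicting (F4).
module Submission where

open import Defs
open import Data.Bool using (Bool; true; false; T; _∧_)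
open import Data.Bool.Properties using (T-∨)
open import Data.Empty using (⊥; ⊥-elim)
open import Data.Fin using (Fin; _≟_)
open import Data.Fin as F using ()
open import Data.List using (List; []; _∷_; _++_; _∷ʳ_; take; length)
open import Data.List.Membership.Propositional using (_∈_)
open import Data.List.Membership.Propositional.Properties using (∈-++⁺ˡ)
open import Data.List.Relation.Binary.Permutation.Propositional using (↭-sym)
open import Data.List.Relation.Binary.Permutation.Propositional.Properties using (∈-resp-↭; ∷↭∷ʳ)
open import Data.List.Relation.Unary.All as All using (All; []; _∷_)
open import Data.List.Relation.Unary.AllPairs using ([]; _∷_)
open import Data.List.Relation.Unary.Any using (here; there)
open import Data.List.Relation.Unary.Unique.Propositional using (Unique)
open import Data.List.Relation.Unary.Unique.Propositional.Properties using (++⁺)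
open import Data.Nat using (ℕ; _+_; _≤_; s≤s; z≤n)
open import Data.Nat.Properties using (≤-trans; m≤n+m; +-mono-≤; <-irrefl; <-cmp)
open import Data.Product using (∃; _×_; _,_; proj₁; proj₂)
open import Data.Product as Product using ()
open import Data.Sum using (_⊎_; inj₁; inj₂; [_,_]; swap; map₂)
open import Data.Unit using (tt)
open import Function using (_∘_; flip; _⇔_; mk⇔; Equivalence)
open import Relation.Binary using (_Respects_; tri<; tri≈; tri>)
open import Relation.Binary.PropositionalEquality using (_≡_; _≢_; refl; sym; cong; subst; ≢-sym)
open import Relation.Nullary using (¬_; yes; no; does)

T-injective : ∀ {a b} → T a ⇔ T b → a ≡ b
T-injective {false} {false} _   = refl
T-injective {false} {true}  a⇔b = ⊥-elim (Equivalence.from a⇔b tt)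
T-injective {true}  {false} a⇔b = ⊥-elim (Equivalence.to a⇔b tt)
T-injective {true}  {true}  _   = refl

1≤count : ∀ {k} (f : Fin k → Bool) r → T (f r) → 1 ≤ count f
1≤count f F.zero    fr with f F.zero
... | true = s≤s z≤n
1≤count f (F.suc r) fr = ≤-trans (1≤count (f ∘ F.suc) r fr) (m≤n+m _ _)

2≤count : ∀ {k} (f : Fin k → Bool) r t → r ≢ t → T (f r) → T (f t) → 2 ≤ count f
2≤count f F.zero    F.zero    r≢t _  _  = ⊥-elim (r≢t refl)
2≤count f F.zero    (F.suc t) _   fr ft with f F.zero
... | true = s≤s (1≤count (f ∘ F.suc) t ft)
2≤count f (F.suc r) F.zero    _   fr ft with f F.zero
... | true = s≤s (1≤count (f ∘ F.suc) r fr)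
2≤count f (F.suc r) (F.suc t) r≢t fr ft =
  ≤-trans (2≤count (f ∘ F.suc) r t (r≢t ∘ cong F.suc) fr ft) (m≤n+m _ _)

data Consec {A : Set} : List A → A → A → Set where
  here  : ∀ {x y ys} → Consec (x ∷ y ∷ ys) x y
  there : ∀ {x xs a b} → Consec xs a b → Consec (x ∷ xs) a b

module _ {A : Set} where

  consec-∈ˡ : ∀ xs {w a b : A} → Consec (xs ∷ʳ w) a b → a ∈ xs
  consec-∈ˡ []           (there ())
  consec-∈ˡ (x ∷ [])     here              = here refl
  consec-∈ˡ (x ∷ [])     (there (there ()))
  consec-∈ˡ (x ∷ y ∷ xs) here              = here refl
  consec-∈ˡ (x ∷ y ∷ xs) (there c)         = there (consec-∈ˡ (y ∷ xs) c)

  consec-∈ʳ : ∀ {w a b : A} {xs} → Consec (w ∷ xs) a b → b ∈ xs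
  consec-∈ʳ here                  = here refl
  consec-∈ʳ {xs = _ ∷ _} (there c) = there (consec-∈ʳ c)

  consec-pred-unique : ∀ {w a a′ b : A} {xs} → Unique xs
                     → Consec (w ∷ xs) a b → Consec (w ∷ xs) a′ b → a ≡ a′
  consec-pred-unique _          here      here       = refl
  consec-pred-unique (y∉ys ∷ _) here      (there c′) = ⊥-elim (All.lookup y∉ys (consec-∈ʳ c′) refl)
  consec-pred-unique (y∉ys ∷ _) (there c) here       = ⊥-elim (All.lookup y∉ys (consec-∈ʳ c) refl)
  consec-pred-unique (_ ∷ ys!)  (there c) (there c′) = consec-pred-unique ys! c c′

  consec-pred-exists : ∀ {w b : A} {xs} → b ∈ xs → ∃ λ a → Consec (w ∷ xs) a b
  consec-pred-exists {w} (here refl) = w , here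
  consec-pred-exists     (there b∈)  = Product.map₂ there (consec-pred-exists b∈)

  module _ {P : A → Set} where

    closed-head : ∀ c ys {z} → P Respects flip (Consec (c ∷ ys)) → z ∈ c ∷ ys → P z → P c
    closed-head c ys       _  (here refl) pz = pz
    closed-head c (d ∷ ys) cl (there z∈)  pz = cl here (closed-head d ys (cl ∘ there) z∈ pz)

    closed-init : ∀ c ys {w} → P Respects flip (Consec (c ∷ ys ∷ʳ w)) → P w → All P (c ∷ ys)
    closed-init c []       cl pw = cl here pw ∷ []
    closed-init c (d ∷ ys) cl pw with closed-init d ys (cl ∘ there) pw
    ... | pd ∷ pys = cl here pd ∷ pd ∷ pys

  unique-rotate : ∀ {x : A} {xs} → Unique (x ∷ xs) → Unique (xs ∷ʳ x)
  unique-rotate (x∉xs ∷ xs!) =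
    ++⁺ xs! ([] ∷ []) λ { (v∈xs , here refl) → All.lookup x∉xs v∈xs refl }

  data CycleStep (xs : List A) (a b : A) : Set where
    ⟨_⟩ : Consec (xs ++ take 1 xs) a b → CycleStep xs a b

  IsTransposition : List A → A → A → Set
  IsTransposition xs a b = xs ≡ a ∷ b ∷ [] ⊎ xs ≡ b ∷ a ∷ []

  step-∈ˡ : ∀ {xs} {a b : A} → CycleStep xs a b → a ∈ xs
  step-∈ˡ {x ∷ xs} ⟨ c ⟩ = consec-∈ˡ (x ∷ xs) c

  step-∈ʳ : ∀ {xs} {a b : A} → CycleStep xs a b → b ∈ xs
  step-∈ʳ {x ∷ xs} ⟨ c ⟩ = ∈-resp-↭ (↭-sym (∷↭∷ʳ x xs)) (consec-∈ʳ c)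

  step-injective : ∀ {xs} {a a′ b : A} → Unique xs → CycleStep xs a b → CycleStep xs a′ b → a ≡ a′
  step-injective {x ∷ xs} xs! ⟨ c ⟩ ⟨ c′ ⟩ = consec-pred-unique (unique-rotate xs!) c c′

  step-surjective : ∀ {xs} {b : A} → b ∈ xs → ∃ λ a → CycleStep xs a b
  step-surjective {x ∷ xs} b∈ = Product.map₂ ⟨_⟩ (consec-pred-exists (∈-resp-↭ (∷↭∷ʳ x xs) b∈))

  cycle-connected : ∀ {P : A → Set} {xs z} → P Respects flip (CycleStep xs) → z ∈ xs → P z → All P xs
  cycle-connected {xs = x ∷ xs} cl z∈ pz =
    closed-init x xs (cl ∘ ⟨_⟩) (closed-head x (xs ∷ʳ x) (cl ∘ ⟨_⟩) (∈-++⁺ˡ z∈) pz)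

  -- {a, b} is closed under predecessors, so it would contain the whole cycle.
  step-asym : ∀ {xs} {a b : A} → Unique xs → 3 ≤ length xs → CycleStep xs a b → ¬ CycleStep xs b a
  step-asym {xs@(c ∷ d ∷ e ∷ _)} {a} {b}
            xs!@((c≢d ∷ c≢e ∷ _) ∷ (d≢e ∷ _) ∷ _) (s≤s (s≤s (s≤s z≤n))) a↦b b↦a
    with cycle-connected {P = λ w → w ≡ a ⊎ w ≡ b} {xs} closed (step-∈ˡ a↦b) (inj₁ refl)
    where
      closed : (λ w → w ≡ a ⊎ w ≡ b) Respects flip (CycleStep xs)
      closed u↦v (inj₁ refl) = inj₂ (step-injective xs! u↦v b↦a)
      closed u↦v (inj₂ refl) = inj₁ (step-injective xs! u↦v a↦b)
  ... | inj₁ refl ∷ inj₁ refl ∷ _          ∷ _ = c≢d refl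
  ... | inj₂ refl ∷ inj₂ refl ∷ _          ∷ _ = c≢d refl
  ... | inj₁ refl ∷ inj₂ refl ∷ inj₁ refl  ∷ _ = c≢e refl
  ... | inj₁ refl ∷ inj₂ refl ∷ inj₂ refl  ∷ _ = d≢e refl
  ... | inj₂ refl ∷ inj₁ refl ∷ inj₁ refl  ∷ _ = d≢e refl
  ... | inj₂ refl ∷ inj₁ refl ∷ inj₂ refl  ∷ _ = c≢e refl

  long-or-transposition : ∀ {xs} {a b : A} → a ≢ b → CycleStep xs a b
                        → 3 ≤ length xs ⊎ IsTransposition xs a b
  long-or-transposition {_ ∷ []}        a≢b ⟨ here ⟩                       = ⊥-elim (a≢b refl)
  long-or-transposition {_ ∷ []}        a≢b ⟨ there (there ()) ⟩
  long-or-transposition {_ ∷ _ ∷ []}    _   ⟨ here ⟩                       = inj₂ (inj₁ refl)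
  long-or-transposition {_ ∷ _ ∷ []}    _   ⟨ there here ⟩                 = inj₂ (inj₂ refl)
  long-or-transposition {_ ∷ _ ∷ []}    _   ⟨ there (there (there ())) ⟩
  long-or-transposition {_ ∷ _ ∷ _ ∷ _} _   _                              = inj₁ (s≤s (s≤s (s≤s z≤n)))

  transposition-steps : ∀ {xs} {a b : A} → IsTransposition xs a b → CycleStep xs a b × CycleStep xs b a
  transposition-steps (inj₁ refl) = ⟨ here ⟩ , ⟨ there here ⟩
  transposition-steps (inj₂ refl) = ⟨ there here ⟩ , ⟨ here ⟩

  long-not-transposition : ∀ {xs} {a b : A} → 3 ≤ length xs → ¬ IsTransposition xs a b
  long-not-transposition (s≤s (s≤s ())) (inj₁ refl)
  long-not-transposition (s≤s (s≤s ())) (inj₂ refl)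

module _ {n : ℕ} where

  T-consec⇒Consec : ∀ xs {x y : Fin n} → T (consec xs x y) → Consec xs x y
  T-consec⇒Consec (a ∷ b ∷ xs) {x} {y} t =
    [ here-case , there ∘ T-consec⇒Consec (b ∷ xs) ]
      (Equivalence.to (T-∨ {does (a ≟ x) ∧ does (b ≟ y)}) t)
    where
      here-case : T (does (a ≟ x) ∧ does (b ≟ y)) → Consec (a ∷ b ∷ xs) x y
      here-case _ with a ≟ x | b ≟ y
      ... | yes refl | yes refl = here

  Consec⇒T-consec : ∀ {xs} {x y : Fin n} → Consec xs x y → T (consec xs x y)
  Consec⇒T-consec {x ∷ y ∷ _} here with x ≟ x | y ≟ y
  ... | yes _  | yes _  = tt
  ... | yes _  | no y≢y = ⊥-elim (y≢y refl)
  ... | no x≢x | _      = ⊥-elim (x≢x refl)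
  Consec⇒T-consec {a ∷ b ∷ _} {x} {y} (there c) with a ≟ x | b ≟ y
  ... | yes _ | yes _ = tt
  ... | yes _ | no _  = Consec⇒T-consec c
  ... | no _  | _     = Consec⇒T-consec c

  maps⇒step : ∀ {xs} {a b : Fin n} → Maps xs a b → CycleStep xs a b
  maps⇒step {xs} m = ⟨ T-consec⇒Consec (xs ++ take 1 xs) m ⟩

  step⇒maps : ∀ {xs} {a b : Fin n} → CycleStep xs a b → Maps xs a b
  step⇒maps ⟨ c ⟩ = Consec⇒T-consec c

  adjacent-∈ : ∀ {xs} {i j : Fin n} → Adjacent xs i j → i ∈ xs
  adjacent-∈ = [ step-∈ˡ ∘ maps⇒step , step-∈ʳ ∘ maps⇒step ]

  adjacent-long-or-transposition : ∀ {xs} {i j : Fin n} → i ≢ j → Adjacent xs i j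
                                 → 3 ≤ length xs ⊎ IsTransposition xs i j
  adjacent-long-or-transposition i≢j (inj₁ i↦j) = long-or-transposition i≢j (maps⇒step i↦j)
  adjacent-long-or-transposition i≢j (inj₂ j↦i) =
    map₂ swap (long-or-transposition (≢-sym i≢j) (maps⇒step j↦i))

module _ {n : ℕ} (I : SF n) (G : GSP I) where
  open SF I
  open GSP G

  Step : Fin k → Fin n → Fin n → Set
  Step r = CycleStep (Π r)

  Long : Fin k → Set
  Long r = 3 ≤ length (Π r)

  transposition-owns-its-steps : ∀ {a b r t} → a ≢ b → IsTransposition (Π t) a b → Step r a b → r ≡ t
  transposition-owns-its-steps {a} {b} {r} {t} a≢b tr a↦b with r ≟ t
  ... | yes r≡t = r≡t
  ... | no r≢t  = ⊥-elim (<-irrefl refl (≤-trans three-steps (F4 a b a≢b)))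
    where
      three-steps : 3 ≤ count (λ s → next (Π s) a b) + count (λ s → next (Π s) b a)
      three-steps = +-mono-≤
        (2≤count _ r t r≢t (step⇒maps a↦b) (step⇒maps (proj₁ (transposition-steps tr))))
        (1≤count _ t (step⇒maps (proj₂ (transposition-steps tr))))

  transposition-owns-adjacency : ∀ {a b r t} → a ≢ b → IsTransposition (Π t) a b → Adjacent (Π r) a b → r ≡ t
  transposition-owns-adjacency a≢b tr (inj₁ a↦b) =
    transposition-owns-its-steps a≢b tr (maps⇒step a↦b)
  transposition-owns-adjacency a≢b tr (inj₂ b↦a) =
    transposition-owns-its-steps (≢-sym a≢b) (swap tr) (maps⇒step b↦a)

  preferred-predecessor-blocks : ∀ {r s p p′ x} → Long r → Step r p x → Step s p′ x → ¬ Prefers x p p′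
  preferred-predecessor-blocks {r} {s} {p} {p′} {x} long p↦x p′↦x x-prefers-p
    with step-surjective (step-∈ˡ p↦x)
  ... | q , q↦p with F1 r p x q (step⇒maps p↦x) (step⇒maps q↦p)
  ... | inj₁ refl = step-asym (unique r) long q↦p p↦x
  ... | inj₂ p-prefers-x =
        F2 x p x≢p not-transposition
           ((s , p′ , step⇒maps p′↦x , x-prefers-p) , (r , q , step⇒maps q↦p , p-prefers-x))
    where
      x≢p : x ≢ p
      x≢p refl = step-asym (unique r) long p↦x p↦x

      not-transposition′ : ∀ {t} → ¬ IsTransposition (Π t) p x
      not-transposition′ tr with transposition-owns-its-steps (≢-sym x≢p) tr p↦x
      ... | refl = long-not-transposition long tr

      not-transposition : ∀ t → Π t ≢ x ∷ p ∷ [] × Π t ≢ p ∷ x ∷ []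
      not-transposition t = not-transposition′ ∘ inj₂ , not-transposition′ ∘ inj₁

  long-cycles-agree-on-predecessors : ∀ {r s p p′ x} → Long r → Long s → Step r p x → Step s p′ x → p ≡ p′
  long-cycles-agree-on-predecessors {p = p} {p′} {x} longʳ longˢ p↦x p′↦x
    with <-cmp (rank x p) (rank x p′)
  ... | tri< x-prefers-p  _ _ = ⊥-elim (preferred-predecessor-blocks longʳ p↦x p′↦x x-prefers-p)
  ... | tri≈ _ same-rank _    = rank-inj x same-rank
  ... | tri> _ _ x-prefers-p′ = ⊥-elim (preferred-predecessor-blocks longˢ p′↦x p↦x x-prefers-p′)

  step-transfer : ∀ {r s a b} → Long r → Long s → Step r a b → b ∈ Π s → Step s a b
  step-transfer longʳ longˢ a↦b b∈ with step-surjective b∈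
  ... | a′ , a′↦b =
    subst (λ u → Step _ u _) (sym (long-cycles-agree-on-predecessors longʳ longˢ a↦b a′↦b)) a′↦b

  shared-agent⇒⊆ : ∀ {r s x} → Long r → Long s → x ∈ Π r → x ∈ Π s → All (_∈ Π s) (Π r)
  shared-agent⇒⊆ longʳ longˢ = cycle-connected (λ a↦b b∈ → step-∈ˡ (step-transfer longʳ longˢ a↦b b∈))

  shared-agent⇒same-steps : ∀ {r s x a b} → Long r → Long s → x ∈ Π r → x ∈ Π s → Step r a b → Step s a b
  shared-agent⇒same-steps longʳ longˢ x∈r x∈s a↦b =
    step-transfer longʳ longˢ a↦b (All.lookup (shared-agent⇒⊆ longʳ longˢ x∈r x∈s) (step-∈ʳ a↦b))

  shared-agent⇒SamePerm : ∀ {r s x} → Long r → Long s → x ∈ Π r → x ∈ Π s → SamePerm (Π r) (Π s)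
  shared-agent⇒SamePerm longʳ longˢ x∈r x∈s =
      (λ _ → mk⇔ (All.lookup (shared-agent⇒⊆ longʳ longˢ x∈r x∈s))
                 (All.lookup (shared-agent⇒⊆ longˢ longʳ x∈s x∈r)))
    , (λ _ _ → T-injective (mk⇔ (step⇒maps ∘ shared-agent⇒same-steps longʳ longˢ x∈r x∈s ∘ maps⇒step)
                                (step⇒maps ∘ shared-agent⇒same-steps longˢ longʳ x∈s x∈r ∘ maps⇒step)))

  distinct-long-cycles-disjoint : ∀ {r s x} → r ≢ s → Long r → Long s → x ∈ Π r → x ∈ Π s → ⊥
  distinct-long-cycles-disjoint {r} {s} r≢s longʳ longˢ x∈r x∈s
    with subst (3 ≤_) (distinct r s r≢s (shared-agent⇒SamePerm longʳ longˢ x∈r x∈s)) longʳ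
  ... | s≤s ()

corollary1 : ∀ {n} (I : SF n) (G : GSP I) (i j : Fin n) → i ≢ j
             → (r s : Fin (GSP.k G)) → r ≢ s
             → Adjacent (GSP.Π G r) i j → Adjacent (GSP.Π G s) i j → ⊥
corollary1 I G i j i≢j r s r≢s adjʳ adjˢ
  with adjacent-long-or-transposition i≢j adjʳ | adjacent-long-or-transposition i≢j adjˢ
... | inj₁ longʳ | inj₁ longˢ =
  distinct-long-cycles-disjoint I G r≢s longʳ longˢ (adjacent-∈ adjʳ) (adjacent-∈ adjˢ)
... | inj₂ trʳ   | _          = r≢s (sym (transposition-owns-adjacency I G i≢j trʳ adjˢ))
... | inj₁ _     | inj₂ trˢ   = r≢s (transposition-owns-adjacency I G i≢j trˢ adjʳ)
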